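{- Let $G=(V,E)$ be a cactus with at least two nodes. Then $|R_2|\le 4|R_1|-8$.
   Context: A cactus is a 2-edge-connected multigraph in which every edge belongs to exactly one circuit; circuits of length 2 (two parallel edges) are called 2-circuits. $R_1$ is the set of nodes of degree 2 (equivalently, incident to exactly one circuit); $R_2$ is the set of nodes incident to at least 3 circuits, or to at least two circuits that are not both 2-circuits. -}

module Defs where

open import Data.Nat using (ℕ; zero; suc; _+_; _*_; _≤_; _≡ᵇ_)
open import Data.Fin using (Fin; zero; suc; inject₁; fromℕ)
open import Data.Fin.Subset using (Subset; _∈_; ∣_∣)
open import Data.Vec using (tabulate)
open import Data.Product using (Σ; ∃; _×_; _,_; proj₁; proj₂)
open import Data.Sum using (_⊎_)
open import Relation.Binary.PropositionalEquality using (_≡_; _≢_)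
open import Relation.Nullary using (¬_)
open import Function.Definitions using (Injective)
open import Data.List using (length; filter; allFin)
open import Data.Bool using (Bool; T)
open import Relation.Nullary.Decidable using (does)
open import Data.Fin.Properties using (_≟_)

record Multigraph : Set where
  field
    n    : ℕ
    m    : ℕ
    ends : Fin m → Fin n × Fin n

module _ (G : Multigraph) where
  open Multigraph G

  Loopless : Set
  Loopless = ∀ e → proj₁ (ends e) ≢ proj₂ (ends e)

  Joins : Fin m → Fin n → Fin n → Set
  Joins e u w = (ends e ≡ (u , w)) ⊎ (ends e ≡ (w , u))

  IncidentEdge : Fin n → Fin m → Set
  IncidentEdge v e = (proj₁ (ends e) ≡ v) ⊎ (proj₂ (ends e) ≡ v)

  incidentᵇ : Fin n → Fin m → Bool
  incidentᵇ v e with does (proj₁ (ends e) ≟ v)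
  ... | Bool.true = Bool.true
  ... | Bool.false = does (proj₂ (ends e) ≟ v)

  -- degree = number of edges incident to v (graph is loopless)
  degree : Fin n → ℕ
  degree v = length (filter (λ e → T? (incidentᵇ v e)) (allFin m))
    where
    open import Data.Bool.Properties using (T?)

  data Reach (allowed : Fin m → Set) : Fin n → Fin n → Set where
    here : ∀ {u} → Reach allowed u u
    step : ∀ {u w x} (e : Fin m) → allowed e → Joins e u w →
           Reach allowed w x → Reach allowed u x

  Connected : Set
  Connected = ∀ u v → Reach (λ _ → ⊤') u v
    where
    open import Data.Unit using () renaming (⊤ to ⊤')

  TwoEdgeConnected : Set
  TwoEdgeConnected = Connected × (∀ f u v → Reach (λ e → e ≢ f) u v)

  -- C ⊆ E is a circuit: its edges are e₀,…,e_{k-1} (distinct, k ≥ 2) joining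
  -- distinct nodes v₀,…,v_{k-1} cyclically (e_i joins v_i and v_{i+1}, v_k = v₀).
  IsCircuit : Subset m → Set
  IsCircuit C =
    Σ ℕ λ k → (2 ≤ k) ×
    Σ (Fin (suc k) → Fin n) λ vs →
    Σ (Fin k → Fin m) λ es →
      (vs (fromℕ k) ≡ vs zero) ×
      Injective _≡_ _≡_ (λ i → vs (inject₁ i)) ×
      Injective _≡_ _≡_ es ×
      (∀ i → Joins (es i) (vs (inject₁ i)) (vs (suc i))) ×
      (∀ e → e ∈ C → ∃ λ i → es i ≡ e) ×
      (∀ i → es i ∈ C)

  EveryEdgeInUniqueCircuit : Set
  EveryEdgeInUniqueCircuit =
    ∀ e → Σ (Subset m) λ C → IsCircuit C × e ∈ C ×
          (∀ C' → IsCircuit C' → e ∈ C' → C' ≡ C)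

  IsCactus : Set
  IsCactus = Loopless × TwoEdgeConnected × EveryEdgeInUniqueCircuit

  IncidentCircuit : Fin n → Subset m → Set
  IncidentCircuit v C = ∃ λ e → e ∈ C × IncidentEdge v e

  Is2Circuit : Subset m → Set
  Is2Circuit C = IsCircuit C × ∣ C ∣ ≡ 2

  R₁ : Subset n
  R₁ = tabulate (λ v → degree v ≡ᵇ 2)

  InR₂ : Fin n → Set
  InR₂ v =
    (Σ (Subset m) λ C₁ → Σ (Subset m) λ C₂ → Σ (Subset m) λ C₃ →
       IsCircuit C₁ × IsCircuit C₂ × IsCircuit C₃ ×
       C₁ ≢ C₂ × C₁ ≢ C₃ × C₂ ≢ C₃ ×
       IncidentCircuit v C₁ × IncidentCircuit v C₂ × IncidentCircuit v C₃)
    ⊎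
    (Σ (Subset m) λ C₁ → Σ (Subset m) λ C₂ →
       IsCircuit C₁ × IsCircuit C₂ × C₁ ≢ C₂ ×
       IncidentCircuit v C₁ × IncidentCircuit v C₂ ×
       ¬ (Is2Circuit C₁ × Is2Circuit C₂))

-- Give every node v the weight w(v) = Σ over the circuits C through v of 3 if C is a 2-circuit and 4
-- otherwise. A circuit with k nodes hands out at most 6(k − 1), and deleting one edge from every circuit
-- leaves a forest, so Σ_C (k_C − 1) ≤ n − 1 and Σ_v w(v) ≤ 6n − 6. On the other hand w(v) ≥ 7 on R₂,
-- w(v) ≥ 6 off R₁ (a node all of whose edges lie on one circuit has degree 2), and w(v) ≥ 3 everywhere
-- (the cactus is connected). Summing, 6n + |R₂| ≤ Σ_v w(v) + 3|R₁| ≤ 6n − 6 + 3|R₁|; then |R₁| ≥ 2 and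
-- |R₂| + 8 ≤ 3|R₁| + 2 ≤ 4|R₁|.

module Submission where

open import Defs
open import Data.Nat using (ℕ; zero; suc; _+_; _*_; _∸_; _≤_; _<_; z≤n; s≤s; _<?_)
import Data.Nat as ℕ
open import Data.Nat.Properties hiding (_≟_)
open import Data.Fin using (Fin; zero; suc; toℕ; fromℕ; fromℕ<; inject₁; punchIn; punchOut)
import Data.Fin as Fin
import Data.Fin.Properties as Fin
open import Data.Fin.Properties
  using (_≟_; punchIn-punchOut; punchOut-injective; toℕ-fromℕ<; toℕ-fromℕ; toℕ-inject₁; toℕ-injective; toℕ<n;
         inject₁-injective)
open import Data.Fin.Subset using (Subset; _∈_; ∣_∣; inside; outside; ⁅_⁆; _∪_) renaming (⊥ to ⊥ˢ)
open import Data.Fin.Subset.Properties using (_∈?_; ∉⊥; x∈p∪q⁻; x∈p∪q⁺; x∈⁅x⁆; x∈⁅y⁆⇒x≡y)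
open import Data.Vec using ([]; _∷_)
open import Data.Bool using (if_then_else_; T)
open import Data.Bool.Properties using (T?; T-≡)
open import Function.Bundles using (Equivalence)
open import Data.Vec.Properties using (lookup⇒[]=; lookup∘tabulate)
open import Data.Product using (Σ; ∃; _×_; _,_; proj₁; proj₂)
open import Data.Sum using (_⊎_; inj₁; inj₂; [_,_]′)
open import Data.Empty using (⊥-elim)
open import Data.Unit using (⊤; tt)
open import Function using (_∘_)
open import Relation.Nullary using (¬_; Dec; yes; no; does; _→-dec_; _×-dec_; ¬?)
open import Relation.Binary.PropositionalEquality
open import Data.List using (List; []; _∷_; length; filter; tabulate; concat)
open import Data.List.Properties using (length-++; length-tabulate)
open import Data.List.Membership.Propositional.Properties using (∈-concat⁻′; ∈-tabulate⁻)
import Data.List.Relation.Unary.All.Properties as All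
import Data.List.Relation.Unary.AllPairs.Properties as AllPairs
import Data.List.Relation.Unary.Unique.Propositional.Properties as Unique
open import Data.List.Relation.Binary.Disjoint.Propositional using (Disjoint)
open import Data.List.Membership.Propositional using () renaming (_∈_ to _∈ₗ_; _∉_ to _∉ₗ_)
open import Data.List.Relation.Unary.Any using (here; there)
open import Data.List.Relation.Unary.AllPairs using ([]; _∷_)
open import Data.List.Relation.Unary.Unique.Propositional using (Unique)
open import Algebra.Properties.Semiring.Sum +-*-semiring
  using (sum; sum-syntax; sum-cong-≗; ∑-comm; ∑-distrib-+; *-distribˡ-sum; sum-remove)

indicator : ∀ {p} {P : Set p} → Dec P → ℕ
indicator P? = if does P? then 1 else 0

indicator-yes : ∀ {p} {P : Set p} (P? : Dec P) → P → indicator P? ≡ 1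
indicator-yes (yes _) _ = refl
indicator-yes (no ¬p) p = ⊥-elim (¬p p)

indicator-no : ∀ {p} {P : Set p} (P? : Dec P) → ¬ P → indicator P? ≡ 0
indicator-no (yes p) ¬p = ⊥-elim (¬p p)
indicator-no (no _) _ = refl

sum-mono-≤ : ∀ {n} {f g : Fin n → ℕ} → (∀ i → f i ≤ g i) → sum f ≤ sum g
sum-mono-≤ {zero} f≤g = z≤n
sum-mono-≤ {suc n} f≤g = +-mono-≤ (f≤g zero) (sum-mono-≤ (f≤g ∘ suc))

∑-const : ∀ n c → ∑[ i < n ] c ≡ n * c
∑-const zero c = refl
∑-const (suc n) c = cong (c +_) (∑-const n c)

∑-*ˡ : ∀ {n} c (f : Fin n → ℕ) → ∑[ i < n ] (c * f i) ≡ c * sum f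
∑-*ˡ c f = sym (*-distribˡ-sum c f)

term≤sum : ∀ {n} (f : Fin n → ℕ) i → f i ≤ sum f
term≤sum {suc n} f i = ≤-trans (m≤m+n (f i) _) (≤-reflexive (sym (sum-remove f)))

two-terms≤sum : ∀ {n} (f : Fin n → ℕ) {i j} → i ≢ j → f i + f j ≤ sum f
two-terms≤sum {suc n} f {i} {j} i≢j = begin
  f i + f j                                  ≡⟨ cong (λ k → f i + f k) (punchIn-punchOut i≢j) ⟨
  f i + f (punchIn i (punchOut i≢j))         ≤⟨ +-monoʳ-≤ (f i) (term≤sum (f ∘ punchIn i) _) ⟩
  f i + ∑[ k < n ] f (punchIn i k)           ≡⟨ sum-remove f ⟨
  sum f                                      ∎
  where open ≤-Reasoning

three-terms≤sum : ∀ {n} (f : Fin n → ℕ) {i j k} → i ≢ j → i ≢ k → j ≢ k →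
                  f i + f j + f k ≤ sum f
three-terms≤sum {suc n} f {i} {j} {k} i≢j i≢k j≢k = begin
  f i + f j + f k                          ≡⟨ +-assoc (f i) _ _ ⟩
  f i + (f j + f k)                        ≡⟨ cong₂ (λ a b → f i + (f a + f b)) (punchIn-punchOut i≢j)
                                                                              (punchIn-punchOut i≢k) ⟨
  f i + (f (punchIn i j′) + f (punchIn i k′))
                                           ≤⟨ +-monoʳ-≤ (f i) (two-terms≤sum (f ∘ punchIn i)
                                                                 (j≢k ∘ punchOut-injective i≢j i≢k)) ⟩
  f i + ∑[ l < n ] f (punchIn i l)         ≡⟨ sum-remove f ⟨
  sum f                                    ∎
  where
  open ≤-Reasoning
  j′ = punchOut i≢j
  k′ = punchOut i≢k

count : ∀ {n p} {P : Fin n → Set p} → (∀ i → Dec (P i)) → ℕ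
count {n} P? = ∑[ i < n ] indicator (P? i)

∑-indicator-≡ : ∀ {n} (x : Fin n) → ∑[ i < n ] indicator (i ≟ x) ≡ 1
∑-indicator-≡ {suc n} zero = cong suc (trans (∑-const n 0) (*-zeroʳ n))
∑-indicator-≡ {suc n} (suc x) = ∑-indicator-≡ x

count≡2 : ∀ {n p} {P : Fin n → Set p} (P? : ∀ i → Dec (P i)) {x y} → x ≢ y →
          (∀ i → P i → i ≡ x ⊎ i ≡ y) → P x → P y → count P? ≡ 2
count≡2 {n} P? {x} {y} x≢y only Px Py = begin
  count P?                                             ≡⟨ sum-cong-≗ pointwise ⟩
  ∑[ i < n ] (indicator (i ≟ x) + indicator (i ≟ y))   ≡⟨ ∑-distrib-+ (λ i → indicator (i ≟ x)) _ ⟩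
  ∑[ i < n ] indicator (i ≟ x) + ∑[ i < n ] indicator (i ≟ y)
                                                       ≡⟨ cong₂ _+_ (∑-indicator-≡ x) (∑-indicator-≡ y) ⟩
  2                                                    ∎
  where
  open ≡-Reasoning
  pointwise : ∀ i → indicator (P? i) ≡ indicator (i ≟ x) + indicator (i ≟ y)
  pointwise i with i ≟ x | i ≟ y
  ... | yes refl | yes refl = ⊥-elim (x≢y refl)
  ... | yes refl | no _ = indicator-yes (P? i) Px
  ... | no _ | yes refl = indicator-yes (P? i) Py
  ... | no i≢x | no i≢y = indicator-no (P? i) λ Pi → [ i≢x , i≢y ]′ (only i Pi)

count-strict-mono : ∀ {n p q} {P : Fin n → Set p} {Q : Fin n → Set q}
                    (P? : ∀ i → Dec (P i)) (Q? : ∀ i → Dec (Q i)) →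
                    (∀ i → Q i → P i) → ∀ {x} → P x → ¬ Q x → count Q? < count P?
count-strict-mono {n} P? Q? Q⇒P {x} Px ¬Qx = begin
  suc (count Q?)                                           ≡⟨ +-comm 1 (count Q?) ⟩
  count Q? + 1                                             ≡⟨ cong (count Q? +_) (∑-indicator-≡ x) ⟨
  count Q? + ∑[ i < n ] indicator (i ≟ x)                  ≡⟨ ∑-distrib-+ (indicator ∘ Q?) _ ⟨
  ∑[ i < n ] (indicator (Q? i) + indicator (i ≟ x))        ≤⟨ sum-mono-≤ pointwise ⟩
  count P?                                                 ∎
  where
  open ≤-Reasoning
  pointwise : ∀ i → indicator (Q? i) + indicator (i ≟ x) ≤ indicator (P? i)
  pointwise i with i ≟ x | Q? i
  ... | yes refl | yes Qx = ⊥-elim (¬Qx Qx)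
  ... | yes refl | no _ = ≤-reflexive (sym (indicator-yes (P? i) Px))
  ... | no _ | yes Qi = ≤-reflexive (sym (indicator-yes (P? i) (Q⇒P i Qi)))
  ... | no _ | no _ = z≤n

∣p∣≡count : ∀ {n} (p : Subset n) → ∣ p ∣ ≡ count (_∈? p)
∣p∣≡count [] = refl
∣p∣≡count (inside ∷ p) = cong suc (∣p∣≡count p)
∣p∣≡count (outside ∷ p) = ∣p∣≡count p

length-filter-tabulate : ∀ {n a p} {A : Set a} {P : A → Set p} (P? : ∀ x → Dec (P x)) (g : Fin n → A) →
                         length (filter P? (tabulate g)) ≡ count (P? ∘ g)
length-filter-tabulate {zero} P? g = refl
length-filter-tabulate {suc n} P? g with P? (g zero)
... | yes _ = cong suc (length-filter-tabulate P? (g ∘ suc))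
... | no _ = length-filter-tabulate P? (g ∘ suc)

length-concat-tabulate : ∀ {a} {A : Set a} {k} (g : Fin k → List A) →
                         length (concat (tabulate g)) ≡ ∑[ i < k ] length (g i)
length-concat-tabulate {k = zero} g = refl
length-concat-tabulate {k = suc k} g =
  trans (length-++ (g zero)) (cong (length (g zero) +_) (length-concat-tabulate (g ∘ suc)))

least : ∀ {m p} {P : Fin m → Set p} → (∀ i → Dec (P i)) → ∀ {i} → P i →
        ∃ λ r → P r × (∀ j → P j → r Fin.≤ j)
least {suc m} P? {i} Pi with P? zero | i
... | yes P0 | _ = zero , P0 , λ _ _ → z≤n
... | no ¬P0 | zero = ⊥-elim (¬P0 Pi)
... | no ¬P0 | suc i′ with least (P? ∘ suc) Pi
...   | r , Pr , minimal = suc r , Pr , λ { zero P0 → ⊥-elim (¬P0 P0) ; (suc j) Pj → s≤s (minimal j Pj) }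

lookupℕ : ∀ {a} {A : Set a} {k} → (Fin (suc k) → A) → ℕ → A
lookupℕ {k = zero} f _ = f zero
lookupℕ {k = suc k} f zero = f zero
lookupℕ {k = suc k} f (suc i) = lookupℕ (f ∘ suc) i

lookupℕ-toℕ : ∀ {a} {A : Set a} {k} (f : Fin (suc k) → A) i → lookupℕ f (toℕ i) ≡ f i
lookupℕ-toℕ {k = zero} f zero = refl
lookupℕ-toℕ {k = suc k} f zero = refl
lookupℕ-toℕ {k = suc k} f (suc i) = lookupℕ-toℕ (f ∘ suc) i

replaceAt : ∀ {a} {A : Set a} → (ℕ → A) → ℕ → A → ℕ → A
replaceAt f i x j with j ℕ.≟ i
... | yes _ = x
... | no _ = f j

replaceAt-≡ : ∀ {a} {A : Set a} (f : ℕ → A) i x → replaceAt f i x i ≡ x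
replaceAt-≡ f i x with i ℕ.≟ i
... | yes _ = refl
... | no i≢i = ⊥-elim (i≢i refl)

replaceAt-≢ : ∀ {a} {A : Set a} (f : ℕ → A) {i j} x → j ≢ i → replaceAt f i x j ≡ f j
replaceAt-≢ f {i} {j} x j≢i with j ℕ.≟ i
... | yes j≡i = ⊥-elim (j≢i j≡i)
... | no _ = refl

imageSet : ∀ {m} → ℕ → (ℕ → Fin m) → Subset m
imageSet zero f = ⊥ˢ
imageSet (suc k) f = ⁅ f k ⁆ ∪ imageSet k f

∈-imageSet⁻ : ∀ {m k} {f : ℕ → Fin m} {x} → x ∈ imageSet k f → ∃ λ i → i < k × f i ≡ x
∈-imageSet⁻ {k = zero} x∈ = ⊥-elim (∉⊥ x∈)
∈-imageSet⁻ {k = suc k} {f} x∈ with x∈p∪q⁻ ⁅ f k ⁆ (imageSet k f) x∈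
... | inj₁ x∈⁅fk⁆ = k , ≤-refl , sym (x∈⁅y⁆⇒x≡y (f k) x∈⁅fk⁆)
... | inj₂ x∈img = let i , i<k , fi≡x = ∈-imageSet⁻ x∈img in i , m<n⇒m<1+n i<k , fi≡x

∈-imageSet⁺ : ∀ {m k} {f : ℕ → Fin m} {i} → i < k → f i ∈ imageSet k f
∈-imageSet⁺ {k = suc k} {f} {i} (s≤s i≤k) with m≤n⇒m<n∨m≡n i≤k
... | inj₁ i<k = x∈p∪q⁺ (inj₂ (∈-imageSet⁺ i<k))
... | inj₂ refl = x∈p∪q⁺ (inj₁ (x∈⁅x⁆ (f i)))

<⇒toℕ : ∀ {i k} → i < k → ∃ λ (j : Fin k) → toℕ j ≡ i
<⇒toℕ i<k = fromℕ< i<k , toℕ-fromℕ< i<k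

module _ (G : Multigraph) where
  open Multigraph G

  Reach-mono : ∀ {A B : Fin m → Set} → (∀ {f} → A f → B f) → ∀ {u x} → Reach G A u x → Reach G B u x
  Reach-mono A⇒B here = here
  Reach-mono A⇒B (step e Ae joins r) = step e (A⇒B Ae) joins (Reach-mono A⇒B r)

  Reach-trans : ∀ {A : Fin m → Set} {u x y} → Reach G A u x → Reach G A x y → Reach G A u y
  Reach-trans here r = r
  Reach-trans (step e Ae joins r) r′ = step e Ae joins (Reach-trans r r′)

  Joins-sym : ∀ {e a b} → Joins G e a b → Joins G e b a
  Joins-sym (inj₁ p) = inj₂ p
  Joins-sym (inj₂ p) = inj₁ p

  Joins-unique : ∀ {e a b c d} → Joins G e a b → Joins G e c d → (a ≡ c × b ≡ d) ⊎ (a ≡ d × b ≡ c)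
  Joins-unique (inj₁ p) (inj₁ q) = inj₁ (cong proj₁ (trans (sym p) q) , cong proj₂ (trans (sym p) q))
  Joins-unique (inj₁ p) (inj₂ q) = inj₂ (cong proj₁ (trans (sym p) q) , cong proj₂ (trans (sym p) q))
  Joins-unique (inj₂ p) (inj₁ q) = inj₂ (cong proj₂ (trans (sym p) q) , cong proj₁ (trans (sym p) q))
  Joins-unique (inj₂ p) (inj₂ q) = inj₁ (cong proj₂ (trans (sym p) q) , cong proj₁ (trans (sym p) q))

  Joins⇒incidentˡ : ∀ {e a b} → Joins G e a b → IncidentEdge G a e
  Joins⇒incidentˡ (inj₁ p) = inj₁ (cong proj₁ p)
  Joins⇒incidentˡ (inj₂ p) = inj₂ (cong proj₂ p)

  Joins⇒incidentʳ : ∀ {e a b} → Joins G e a b → IncidentEdge G b e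
  Joins⇒incidentʳ = Joins⇒incidentˡ ∘ Joins-sym

  incident⇒endpoint : ∀ {e a b v} → Joins G e a b → IncidentEdge G v e → v ≡ a ⊎ v ≡ b
  incident⇒endpoint (inj₁ p) (inj₁ q) = inj₁ (trans (sym q) (cong proj₁ p))
  incident⇒endpoint (inj₁ p) (inj₂ q) = inj₂ (trans (sym q) (cong proj₂ p))
  incident⇒endpoint (inj₂ p) (inj₁ q) = inj₂ (trans (sym q) (cong proj₁ p))
  incident⇒endpoint (inj₂ p) (inj₂ q) = inj₁ (trans (sym q) (cong proj₂ p))

  incidentᵇ⇒incident : ∀ {v e} → T (incidentᵇ G v e) → IncidentEdge G v e
  incidentᵇ⇒incident {v} {e} t with proj₁ (ends e) ≟ v
  ... | yes p = inj₁ p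
  ... | no _ with proj₂ (ends e) ≟ v
  ...   | yes q = inj₂ q

  incident⇒incidentᵇ : ∀ {v e} → IncidentEdge G v e → T (incidentᵇ G v e)
  incident⇒incidentᵇ {v} {e} v∼e with proj₁ (ends e) ≟ v
  ... | yes _ = tt
  ... | no ¬p with proj₂ (ends e) ≟ v
  ...   | yes _ = tt
  ...   | no ¬q = [ ¬p , ¬q ]′ v∼e

  degree≡count : ∀ v → degree G v ≡ count (λ e → T? (incidentᵇ G v e))
  degree≡count v = length-filter-tabulate (λ e → T? (incidentᵇ G v e)) (λ e → e)

  -- A circuit indexed by ℕ, so that successor and predecessor of positions are plain arithmetic.
  record Cycle (C : Subset m) : Set where
    field
      len : ℕ
      2≤len : 2 ≤ len
      node : ℕ → Fin n
      edge : ℕ → Fin m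
      node-closed : node len ≡ node 0
      node-injective : ∀ {i j} → i < len → j < len → node i ≡ node j → i ≡ j
      edge-injective : ∀ {i j} → i < len → j < len → edge i ≡ edge j → i ≡ j
      edge-joins : ∀ {i} → i < len → Joins G (edge i) (node i) (node (suc i))
      ∈⇒edge : ∀ {f} → f ∈ C → ∃ λ i → i < len × edge i ≡ f
      edge∈ : ∀ {i} → i < len → edge i ∈ C

    prev : ℕ → ℕ
    prev zero = len ∸ 1
    prev (suc i) = i

    0<len : 0 < len
    0<len = ≤-trans (s≤s z≤n) 2≤len

    prev<len : ∀ {i} → i < len → prev i < len
    prev<len {zero} _ = ≤-reflexive (m+[n∸m]≡n 0<len)
    prev<len {suc i} i<len = <-trans (n<1+n i) i<len

    next-position : ∀ {i} → i < len → ∃ λ i′ → i′ < len × node i′ ≡ node (suc i) × prev i′ ≡ i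
    next-position {i} i<len with suc i <? len
    ... | yes 1+i<len = suc i , 1+i<len , refl , refl
    ... | no 1+i≮len = 0 , 0<len , trans (sym node-closed) (cong node (sym 1+i≡len)) , cong (_∸ 1) (sym 1+i≡len)
      where
      1+i≡len : suc i ≡ len
      1+i≡len = ≤-antisym i<len (≮⇒≥ 1+i≮len)

    incident⇒on-cycle : ∀ {f v} → f ∈ C → IncidentEdge G v f → ∃ λ j → j < len × node j ≡ v
    incident⇒on-cycle f∈C v∼f with ∈⇒edge f∈C
    ... | i , i<len , refl with incident⇒endpoint (edge-joins i<len) v∼f
    ...   | inj₁ v≡node-i = i , i<len , sym v≡node-i
    ...   | inj₂ v≡node-1+i = let i′ , i′<len , node-i′ , _ = next-position i<len in
                              i′ , i′<len , trans node-i′ (sym v≡node-1+i)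

    incident-edges : ∀ {j v f} → j < len → node j ≡ v → f ∈ C → IncidentEdge G v f →
                     f ≡ edge j ⊎ f ≡ edge (prev j)
    incident-edges j<len node-j f∈C v∼f with ∈⇒edge f∈C
    ... | i , i<len , refl with incident⇒endpoint (edge-joins i<len) v∼f
    ...   | inj₁ v≡node-i = inj₁ (cong edge (node-injective i<len j<len (trans (sym v≡node-i) (sym node-j))))
    ...   | inj₂ v≡node-1+i with next-position i<len
    ...     | i′ , i′<len , node-i′ , prev-i′ with node-injective i′<len j<len
                                                   (trans node-i′ (trans (sym v≡node-1+i) (sym node-j)))
    ...       | refl = inj₂ (cong edge (sym prev-i′))

    edge-incident : ∀ {j} → j < len → IncidentEdge G (node j) (edge j)
    edge-incident j<len = Joins⇒incidentˡ (edge-joins j<len)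

    prev-edge-incident : ∀ {j} → j < len → IncidentEdge G (node j) (edge (prev j))
    prev-edge-incident {zero} _ =
      subst (λ x → IncidentEdge G x (edge (len ∸ 1)))
            (trans (cong node (m+[n∸m]≡n 0<len)) node-closed) (Joins⇒incidentʳ (edge-joins (prev<len 0<len)))
    prev-edge-incident {suc j} 1+j<len = Joins⇒incidentʳ (edge-joins (<-trans (n<1+n j) 1+j<len))

    edge≢prev-edge : ∀ {j} → j < len → edge j ≢ edge (prev j)
    edge≢prev-edge {zero} j<len eq with edge-injective 0<len (prev<len 0<len) eq
    ... | 0≡len∸1 = <-irrefl (cong suc 0≡len∸1) (subst (2 ≤_) (sym (m+[n∸m]≡n 0<len)) 2≤len)
    edge≢prev-edge {suc j} j<len eq = 1+n≢n (edge-injective j<len (prev<len j<len) eq)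

    degree≡2 : ∀ {j v} → j < len → node j ≡ v → (∀ {f} → IncidentEdge G v f → f ∈ C) → degree G v ≡ 2
    degree≡2 {j} {v} j<len refl all-in = trans (degree≡count v)
      (count≡2 (λ e → T? (incidentᵇ G v e)) (edge≢prev-edge j<len)
        (λ f t → let v∼f = incidentᵇ⇒incident t in incident-edges j<len refl (all-in v∼f) v∼f)
        (incident⇒incidentᵇ (edge-incident j<len)) (incident⇒incidentᵇ (prev-edge-incident j<len)))

    visits : Fin n → ℕ
    visits v = ∑[ j < len ] indicator (v ≟ node (toℕ j))

    ∑-visits : ∑[ v < n ] visits v ≡ len
    ∑-visits = begin
      ∑[ v < n ] ∑[ j < len ] indicator (v ≟ node (toℕ j))
        ≡⟨ ∑-comm {n} {len} (λ v j → indicator (v ≟ node (toℕ j))) ⟩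
      ∑[ j < len ] ∑[ v < n ] indicator (v ≟ node (toℕ j))
        ≡⟨ sum-cong-≗ {len} (∑-indicator-≡ ∘ node ∘ toℕ) ⟩
      ∑[ j < len ] 1
        ≡⟨ trans (∑-const len 1) (*-identityʳ len) ⟩
      len ∎
      where open ≡-Reasoning

    on-cycle⇒visits : ∀ {j v} → j < len → node j ≡ v → 1 ≤ visits v
    on-cycle⇒visits {j} {v} j<len node-j = ≤-trans (≤-reflexive (sym visited)) (term≤sum _ (fromℕ< j<len))
      where
      visited : indicator (v ≟ node (toℕ (fromℕ< j<len))) ≡ 1
      visited = indicator-yes (v ≟ _) (sym (trans (cong node (toℕ-fromℕ< j<len)) node-j))

    ∣C∣≡2 : len ≡ 2 → ∣ C ∣ ≡ 2
    ∣C∣≡2 len≡2 = trans (∣p∣≡count C)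
      (count≡2 (_∈? C) (λ eq → 0≢1+n (edge-injective 0<len 1<len eq)) only-two (edge∈ 0<len) (edge∈ 1<len))
      where
      1<len : 1 < len
      1<len = subst (1 <_) (sym len≡2) (s≤s (s≤s z≤n))
      only-two : ∀ f → f ∈ C → f ≡ edge 0 ⊎ f ≡ edge 1
      only-two f f∈C with ∈⇒edge f∈C
      ... | 0 , _ , refl = inj₁ refl
      ... | 1 , _ , refl = inj₂ refl
      ... | suc (suc i) , i<len , _ = ⊥-elim (3+i≰2 (subst (suc (suc (suc i)) ≤_) len≡2 i<len))
        where
        3+i≰2 : ¬ 3 + i ≤ 2
        3+i≰2 (s≤s (s≤s ()))

  isCircuit⇒cycle : ∀ {C} → IsCircuit G C → Cycle C
  isCircuit⇒cycle (zero , () , _)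
  isCircuit⇒cycle {C} (suc k , 2≤k , vs , es , closed , vs-inj , es-inj , joins , ∈⇒es , es∈) = record
    { len = suc k ; 2≤len = 2≤k ; node = lookupℕ vs ; edge = lookupℕ es
    ; node-closed = trans (node-at (fromℕ (suc k)) (toℕ-fromℕ (suc k))) (trans closed (node-at zero refl))
    ; node-injective = node-injective ; edge-injective = edge-injective
    ; edge-joins = edge-joins ; ∈⇒edge = ∈⇒edge ; edge∈ = edge∈ }
    where
    node-at : ∀ j {i} → toℕ j ≡ i → lookupℕ vs i ≡ vs j
    node-at j refl = lookupℕ-toℕ vs j
    node-inject₁ : ∀ j → lookupℕ vs (toℕ j) ≡ vs (inject₁ j)
    node-inject₁ j = node-at (inject₁ j) (toℕ-inject₁ j)
    node-injective : ∀ {i j} → i < suc k → j < suc k → lookupℕ vs i ≡ lookupℕ vs j → i ≡ j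
    node-injective i<k j<k eq with <⇒toℕ i<k | <⇒toℕ j<k
    ... | a , refl | b , refl =
      cong toℕ (vs-inj (trans (sym (node-inject₁ a)) (trans eq (node-inject₁ b))))
    edge-injective : ∀ {i j} → i < suc k → j < suc k → lookupℕ es i ≡ lookupℕ es j → i ≡ j
    edge-injective i<k j<k eq with <⇒toℕ i<k | <⇒toℕ j<k
    ... | a , refl | b , refl =
      cong toℕ (es-inj (trans (sym (lookupℕ-toℕ es a)) (trans eq (lookupℕ-toℕ es b))))
    edge-joins : ∀ {i} → i < suc k → Joins G (lookupℕ es i) (lookupℕ vs i) (lookupℕ vs (suc i))
    edge-joins i<k with <⇒toℕ i<k
    ... | a , refl rewrite lookupℕ-toℕ es a | node-inject₁ a = subst (Joins G (es a) (vs (inject₁ a)))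
          (sym (lookupℕ-toℕ vs (suc a))) (joins a)
    ∈⇒edge : ∀ {f} → f ∈ C → ∃ λ i → i < suc k × lookupℕ es i ≡ f
    ∈⇒edge f∈C with ∈⇒es _ f∈C
    ... | a , refl = toℕ a , toℕ<n a , lookupℕ-toℕ es a
    edge∈ : ∀ {i} → i < suc k → lookupℕ es i ∈ C
    edge∈ i<k with <⇒toℕ i<k
    ... | a , refl = subst (_∈ C) (sym (lookupℕ-toℕ es a)) (es∈ a)

  cycle⇒isCircuit : ∀ {C} → Cycle C → IsCircuit G C
  cycle⇒isCircuit {C} c =
    len , 2≤len , (node ∘ toℕ) , (edge ∘ toℕ) ,
    subst (λ i → node i ≡ node 0) (sym (toℕ-fromℕ len)) node-closed ,
    (λ {i} {j} eq → inject₁-injective (toℕ-injective (node-injective (inject₁<len i) (inject₁<len j) eq))) ,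
    (λ {i} {j} eq → toℕ-injective (edge-injective (toℕ<n i) (toℕ<n j) eq)) ,
    (λ i → subst (λ x → Joins G (edge (toℕ i)) (node x) (node (suc (toℕ i))))
             (sym (toℕ-inject₁ i)) (edge-joins (toℕ<n i))) ,
    (λ f f∈C → let i , i<len , eq = ∈⇒edge f∈C in fromℕ< i<len , trans (cong edge (toℕ-fromℕ< i<len)) eq) ,
    (λ i → edge∈ (toℕ<n i))
    where
    open Cycle c
    inject₁<len : (i : Fin len) → toℕ (inject₁ i) < len
    inject₁<len i = subst (_< len) (sym (toℕ-inject₁ i)) (toℕ<n i)

  record Path (A : Fin m → Set) (u x : Fin n) : Set where
    field
      len : ℕ
      node : ℕ → Fin n
      edge : ℕ → Fin m
      node-start : node 0 ≡ u
      node-end : node len ≡ x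
      node-injective : ∀ {i j} → i ≤ len → j ≤ len → node i ≡ node j → i ≡ j
      edge-joins : ∀ {i} → i < len → Joins G (edge i) (node i) (node (suc i))
      edge-allowed : ∀ {i} → i < len → A (edge i)

    edge-injective : ∀ {i j} → i < len → j < len → edge i ≡ edge j → i ≡ j
    edge-injective {i} {j} i<len j<len eq
      with Joins-unique (edge-joins i<len)
                        (subst (λ f → Joins G f (node j) (node (suc j))) (sym eq) (edge-joins j<len))
    ... | inj₁ (same , _) = node-injective (<⇒≤ i<len) (<⇒≤ j<len) same
    ... | inj₂ (crossed₁ , crossed₂) =
      ⊥-elim (<-asym (≤-reflexive (sym (node-injective (<⇒≤ i<len) j<len crossed₁)))
                     (≤-reflexive (node-injective i<len (<⇒≤ j<len) crossed₂)))

    drop : ∀ j → j ≤ len → Path A (node j) x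
    drop j j≤len = record
      { len = len ∸ j ; node = λ i → node (j + i) ; edge = λ i → edge (j + i)
      ; node-start = cong node (+-identityʳ j) ; node-end = trans (cong node (m+[n∸m]≡n j≤len)) node-end
      ; node-injective = λ i≤ i′≤ eq → +-cancelˡ-≡ j _ _ (node-injective (shift-≤ i≤) (shift-≤ i′≤) eq)
      ; edge-joins = λ {i} i< → subst (λ k → Joins G (edge (j + i)) (node (j + i)) (node k))
                                      (sym (+-suc j i)) (edge-joins (shift-< i<))
      ; edge-allowed = λ i< → edge-allowed (shift-< i<) }
      where
      shift-≤ : ∀ {i} → i ≤ len ∸ j → j + i ≤ len
      shift-≤ {i} i≤ = subst (j + i ≤_) (m+[n∸m]≡n j≤len) (+-monoʳ-≤ j i≤)
      shift-< : ∀ {i} → i < len ∸ j → j + i < len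
      shift-< {i} i< = subst (_≤ len) (+-suc j i) (shift-≤ i<)

  open Path using (drop)

  -- The edge argument only fills the (unused) edge positions of a path of length 0.
  trivialPath : ∀ {A u} → Fin m → Path A u u
  trivialPath {u = u} e = record
    { len = 0 ; node = λ _ → u ; edge = λ _ → e ; node-start = refl ; node-end = refl
    ; node-injective = λ { z≤n z≤n _ → refl } ; edge-joins = λ () ; edge-allowed = λ () }

  cons : ∀ {A e u w x} → A e → Joins G e u w → (p : Path A w x) →
         (∀ {i} → i ≤ Path.len p → Path.node p i ≢ u) → Path A u x
  cons {A} {e} {u} Ae joins p u∉p = record
    { len = suc len ; node = node′ ; edge = edge′ ; node-start = refl ; node-end = node-end
    ; node-injective = node-injective′ ; edge-joins = edge-joins′ ; edge-allowed = edge-allowed′ }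
    where
    open Path p
    node′ : ℕ → Fin n
    node′ zero = u
    node′ (suc i) = node i
    edge′ : ℕ → Fin m
    edge′ zero = e
    edge′ (suc i) = edge i
    node-injective′ : ∀ {i j} → i ≤ suc len → j ≤ suc len → node′ i ≡ node′ j → i ≡ j
    node-injective′ {zero} {zero} _ _ _ = refl
    node-injective′ {zero} {suc j} _ (s≤s j≤len) eq = ⊥-elim (u∉p j≤len (sym eq))
    node-injective′ {suc i} {zero} (s≤s i≤len) _ eq = ⊥-elim (u∉p i≤len eq)
    node-injective′ {suc i} {suc j} (s≤s i≤len) (s≤s j≤len) eq = cong suc (node-injective i≤len j≤len eq)
    edge-joins′ : ∀ {i} → i < suc len → Joins G (edge′ i) (node′ i) (node′ (suc i))
    edge-joins′ {zero} _ = subst (Joins G e u) (sym node-start) joins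
    edge-joins′ {suc i} (s≤s i<len) = edge-joins i<len
    edge-allowed′ : ∀ {i} → i < suc len → A (edge′ i)
    edge-allowed′ {zero} _ = Ae
    edge-allowed′ {suc i} (s≤s i<len) = edge-allowed i<len

  reach⇒path : ∀ {A u x} → Fin m → Reach G A u x → Path A u x
  reach⇒path e here = trivialPath e
  reach⇒path {u = u} e (step _ Ae joins r) with reach⇒path e r
  ... | p with anyUpTo? (λ i → Path.node p i ≟ u) (suc (Path.len p))
  ...   | yes (j , s≤s j≤len , node-j≡u) = subst (λ y → Path _ y _) node-j≡u (drop p j j≤len)
  ...   | no u∉p = cons Ae joins p λ {i} i≤len node-i≡u → u∉p (i , s≤s i≤len , node-i≡u)

  circuit-through : ∀ {A : Fin m → Set} {e a b} → Joins G e a b → a ≢ b → (∀ {f} → A f → f ≢ e) →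
                    Reach G A a b → Σ (Subset m) λ C → IsCircuit G C × e ∈ C × (∀ {f} → f ∈ C → f ≡ e ⊎ A f)
  circuit-through {A} {e} {a} {b} joins a≢b A∌e r =
    imageSet (suc len) edge′ , cycle⇒isCircuit closed , e∈circuit , circuit⊆e∪A
    where
    open Path (reach⇒path e r)
    node′ edge′ : ℕ → _
    node′ = replaceAt node (suc len) a
    edge′ = replaceAt edge len e

    node′-≤ : ∀ {i} → i ≤ len → node′ i ≡ node i
    node′-≤ i≤len = replaceAt-≢ node a (<⇒≢ (s≤s i≤len))
    edge′-< : ∀ {i} → i < len → edge′ i ≡ edge i
    edge′-< i<len = replaceAt-≢ edge e (<⇒≢ i<len)
    edge′-len : edge′ len ≡ e
    edge′-len = replaceAt-≡ edge len e

    position : ∀ {i} → i < suc len → i < len ⊎ i ≡ len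
    position (s≤s i≤len) = m≤n⇒m<n∨m≡n i≤len

    1≤len : 1 ≤ len
    1≤len = n≢0⇒n>0 λ len≡0 → a≢b (trans (sym node-start) (trans (cong node (sym len≡0)) node-end))

    e∉A-edges : ∀ {i} → i < len → edge′ i ≢ e
    e∉A-edges i<len eq = A∌e (edge-allowed i<len) (trans (sym (edge′-< i<len)) eq)

    edge′-injective : ∀ {i j} → i < suc len → j < suc len → edge′ i ≡ edge′ j → i ≡ j
    edge′-injective i< j< eq with position i< | position j<
    ... | inj₁ i<len | inj₁ j<len =
      edge-injective i<len j<len (trans (sym (edge′-< i<len)) (trans eq (edge′-< j<len)))
    ... | inj₁ i<len | inj₂ refl = ⊥-elim (e∉A-edges i<len (trans eq edge′-len))
    ... | inj₂ refl | inj₁ j<len = ⊥-elim (e∉A-edges j<len (trans (sym eq) edge′-len))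
    ... | inj₂ refl | inj₂ refl = refl

    edge′-joins : ∀ {i} → i < suc len → Joins G (edge′ i) (node′ i) (node′ (suc i))
    edge′-joins i< with position i<
    ... | inj₁ i<len rewrite edge′-< i<len | node′-≤ (<⇒≤ i<len) | node′-≤ i<len = edge-joins i<len
    ... | inj₂ refl rewrite edge′-len | node′-≤ (≤-refl {len}) | replaceAt-≡ node (suc len) a =
      subst (λ y → Joins G e y a) (sym node-end) (Joins-sym joins)

    closed : Cycle (imageSet (suc len) edge′)
    closed = record
      { len = suc len ; 2≤len = s≤s 1≤len ; node = node′ ; edge = edge′
      ; node-closed = trans (replaceAt-≡ node (suc len) a) (sym (trans (node′-≤ z≤n) node-start))
      ; node-injective = λ i< j< eq → node-injective (≤-pred i<) (≤-pred j<)
                                        (trans (sym (node′-≤ (≤-pred i<))) (trans eq (node′-≤ (≤-pred j<))))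
      ; edge-injective = edge′-injective ; edge-joins = edge′-joins
      ; ∈⇒edge = ∈-imageSet⁻ ; edge∈ = ∈-imageSet⁺ }

    e∈circuit : e ∈ imageSet (suc len) edge′
    e∈circuit = subst (_∈ imageSet (suc len) edge′) edge′-len (∈-imageSet⁺ (n<1+n len))

    circuit⊆e∪A : ∀ {f} → f ∈ imageSet (suc len) edge′ → f ≡ e ⊎ A f
    circuit⊆e∪A f∈ with ∈-imageSet⁻ {f = edge′} f∈
    ... | i , i< , refl with position i<
    ...   | inj₁ i<len = inj₂ (subst A (sym (edge′-< i<len)) (edge-allowed i<len))
    ...   | inj₂ refl = inj₁ edge′-len

  Reach⇒incident : ∀ {A u w} → Reach G A u w → u ≢ w → ∃ (IncidentEdge G u)
  Reach⇒incident here u≢u = ⊥-elim (u≢u refl)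
  Reach⇒incident (step e _ joins _) _ = e , Joins⇒incidentˡ joins

  connected⇒incident : Connected G → 2 ≤ n → ∀ v → ∃ (IncidentEdge G v)
  connected⇒incident connected 2≤n v = pick (v ≟ x₀)
    where
    0<n : 0 < n
    0<n = <-trans (s≤s z≤n) 2≤n
    x₀ x₁ : Fin n
    x₀ = fromℕ< 0<n
    x₁ = fromℕ< 2≤n
    x₀≢x₁ : x₀ ≢ x₁
    x₀≢x₁ eq = 0≢1+n (trans (sym (toℕ-fromℕ< 0<n)) (trans (cong toℕ eq) (toℕ-fromℕ< 2≤n)))
    pick : Dec (v ≡ x₀) → ∃ (IncidentEdge G v)
    pick (yes refl) = Reach⇒incident (connected x₀ x₁) x₀≢x₁
    pick (no v≢x₀) = Reach⇒incident (connected v x₀) v≢x₀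

  -- A partition of the nodes into A-connected classes, each named by a representative node;
  -- the representatives are the fixed points of label.
  record Partition (A : Fin m → Set) : Set where
    field
      label : Fin n → Fin n
      label-idem : ∀ x → label (label x) ≡ label x
      label⇒Reach : ∀ {x y} → label x ≡ label y → Reach G A x y

    classes : ℕ
    classes = count (λ x → label x ≟ x)

    1≤classes : Fin n → 1 ≤ classes
    1≤classes x = ≤-trans (≤-reflexive (sym (indicator-yes (label (label x) ≟ label x) (label-idem x))))
                          (term≤sum _ (label x))

  open Partition

  discrete : ∀ {A} → Partition A
  discrete = record { label = λ x → x ; label-idem = λ _ → refl ; label⇒Reach = λ { refl → here } }

  classes-discrete : ∀ {A} → classes (discrete {A}) ≡ n
  classes-discrete =
    trans (sum-cong-≗ {n} (λ x → indicator-yes (x ≟ x) refl)) (trans (∑-const n 1) (*-identityʳ n))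

  Partition-mono : ∀ {A B : Fin m → Set} → (∀ {f} → A f → B f) → Partition A → Partition B
  Partition-mono A⇒B P = record
    { label = label P ; label-idem = label-idem P ; label⇒Reach = Reach-mono A⇒B ∘ label⇒Reach P }

  merge : ∀ {A e a b} (P : Partition A) → Joins G e a b → label P a ≢ label P b →
          Σ (Partition (λ f → f ≡ e ⊎ A f)) λ P′ → classes P′ < classes P
  merge {A} {e} {a} {b} P joins a≁b = P′ , count-strict-mono (λ x → ℓ x ≟ x) (λ x → ℓ′ x ≟ x) fixed-kept
                                                           (label-idem P a) ℓa-moved
    where
    ℓ = label P
    ℓ′ : Fin n → Fin n
    ℓ′ x with ℓ x ≟ ℓ a
    ... | yes _ = ℓ b
    ... | no _ = ℓ x

    ℓ′-moved : ∀ {x} → ℓ x ≡ ℓ a → ℓ′ x ≡ ℓ b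
    ℓ′-moved {x} x∼a with ℓ x ≟ ℓ a
    ... | yes _ = refl
    ... | no x≁a = ⊥-elim (x≁a x∼a)
    ℓ′-kept : ∀ {x} → ℓ x ≢ ℓ a → ℓ′ x ≡ ℓ x
    ℓ′-kept {x} x≁a with ℓ x ≟ ℓ a
    ... | yes x∼a = ⊥-elim (x≁a x∼a)
    ... | no _ = refl

    old : ∀ {x y} → ℓ x ≡ ℓ y → Reach G (λ f → f ≡ e ⊎ A f) x y
    old = Reach-mono inj₂ ∘ label⇒Reach P

    ℓb-kept : ℓ (ℓ b) ≢ ℓ a
    ℓb-kept b∼a = a≁b (sym (trans (sym (label-idem P b)) b∼a))

    P′ : Partition (λ f → f ≡ e ⊎ A f)
    P′ .label = ℓ′
    P′ .label-idem x with ℓ x ≟ ℓ a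
    ... | yes _ = trans (ℓ′-kept ℓb-kept) (label-idem P b)
    ... | no x≁a = trans (ℓ′-kept (λ x∼a → x≁a (trans (sym (label-idem P x)) x∼a))) (label-idem P x)
    P′ .label⇒Reach {x} {y} eq with ℓ x ≟ ℓ a | ℓ y ≟ ℓ a
    ... | yes x∼a | yes y∼a = old (trans x∼a (sym y∼a))
    ... | yes x∼a | no _ = Reach-trans (old x∼a) (step e (inj₁ refl) joins (old eq))
    ... | no _ | yes y∼a = Reach-trans (old eq) (step e (inj₁ refl) (Joins-sym joins) (old (sym y∼a)))
    ... | no _ | no _ = old eq

    fixed-kept : ∀ x → ℓ′ x ≡ x → ℓ x ≡ x
    fixed-kept x fixed with ℓ x ≟ ℓ a
    ... | yes _ = trans (cong ℓ (sym fixed)) (trans (label-idem P b) fixed)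
    ... | no _ = fixed
    ℓa-moved : ℓ′ (ℓ a) ≢ ℓ a
    ℓa-moved moved = a≁b (sym (trans (sym (ℓ′-moved (label-idem P a))) moved))

  Acyclic : List (Fin m) → Set
  Acyclic [] = ⊤
  Acyclic (e ∷ es) = ¬ Reach G (_∈ₗ es) (proj₁ (ends e)) (proj₂ (ends e)) × Acyclic es

  acyclic⇒partition : ∀ {es} → Acyclic es → Σ (Partition (_∈ₗ es)) λ P → classes P + length es ≤ n
  acyclic⇒partition {[]} _ = discrete , ≤-reflexive (trans (+-identityʳ _) (classes-discrete {_∈ₗ []}))
  acyclic⇒partition {e ∷ es} (no-cycle , acyclic) with acyclic⇒partition acyclic
  ... | P , bound with merge P (inj₁ refl) (no-cycle ∘ label⇒Reach P)
  ...   | P′ , fewer = Partition-mono [ here , there ]′ P′ , (begin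
    classes P′ + suc (length es)  ≡⟨ +-suc (classes P′) (length es) ⟩
    suc (classes P′) + length es  ≤⟨ +-monoˡ-≤ (length es) fewer ⟩
    classes P + length es         ≤⟨ bound ⟩
    n                             ∎)
    where open ≤-Reasoning

  acyclic-length : ∀ {es} → Fin n → Acyclic es → length es < n
  acyclic-length {es} x acyclic with acyclic⇒partition acyclic
  ... | P , bound = ≤-trans (+-monoˡ-≤ (length es) (1≤classes P x)) bound

  circuit-free⇒acyclic : Loopless G → ∀ {es} → Unique es →
                         (∀ {C} → IsCircuit G C → ∃ λ f → f ∈ C × f ∉ₗ es) → Acyclic es
  circuit-free⇒acyclic loopless {[]} _ _ = tt
  circuit-free⇒acyclic loopless {e ∷ es} (e∉es ∷ unique) misses =
    no-cycle ,
    circuit-free⇒acyclic loopless unique (λ isC → let f , f∈C , f∉ = misses isC in f , f∈C , f∉ ∘ there)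
    where
    no-cycle : ¬ Reach G (_∈ₗ es) (proj₁ (ends e)) (proj₂ (ends e))
    no-cycle r with circuit-through (inj₁ refl) (loopless e)
                      (λ f∈es f≡e → All.All¬⇒¬Any e∉es (subst (_∈ₗ es) f≡e f∈es)) r
    ... | C , isC , _ , C⊆e∪es with misses isC
    ...   | f , f∈C , f∉e∷es = f∉e∷es ([ here , there ]′ (C⊆e∪es f∈C))

cycleWeight : ℕ → ℕ
cycleWeight 2 = 3
cycleWeight _ = 4

3≤cycleWeight : ∀ k → 3 ≤ cycleWeight k
3≤cycleWeight 0 = n≤1+n 3
3≤cycleWeight 1 = n≤1+n 3
3≤cycleWeight 2 = ≤-refl
3≤cycleWeight (suc (suc (suc _))) = n≤1+n 3

cycleWeight-≢2 : ∀ {k} → k ≢ 2 → cycleWeight k ≡ 4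
cycleWeight-≢2 {0} _ = refl
cycleWeight-≢2 {1} _ = refl
cycleWeight-≢2 {2} k≢2 = ⊥-elim (k≢2 refl)
cycleWeight-≢2 {suc (suc (suc _))} _ = refl

cycleWeight*k≤6*[k-1] : ∀ k → 2 ≤ k → cycleWeight k * k ≤ 6 * (k ∸ 1)
cycleWeight*k≤6*[k-1] 1 (s≤s ())
cycleWeight*k≤6*[k-1] 2 _ = ≤-refl
cycleWeight*k≤6*[k-1] (suc (suc (suc k))) _ = begin
  4 * (3 + k)   ≡⟨ *-distribˡ-+ 4 3 k ⟩
  12 + 4 * k    ≤⟨ +-monoʳ-≤ 12 (*-monoˡ-≤ k (m≤m+n 4 2)) ⟩
  12 + 6 * k    ≡⟨ *-distribˡ-+ 6 2 k ⟨
  6 * (2 + k)   ∎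
  where open ≤-Reasoning

module Cactus (G : Multigraph) (loopless : Loopless G) (unique : EveryEdgeInUniqueCircuit G) where
  open Multigraph G

  circuitOf : Fin m → Subset m
  circuitOf e = proj₁ (unique e)

  circuitOf-isCircuit : ∀ e → IsCircuit G (circuitOf e)
  circuitOf-isCircuit e = proj₁ (proj₂ (unique e))

  ∈-circuitOf : ∀ e → e ∈ circuitOf e
  ∈-circuitOf e = proj₁ (proj₂ (proj₂ (unique e)))

  circuitOf-unique : ∀ {e C} → IsCircuit G C → e ∈ C → C ≡ circuitOf e
  circuitOf-unique {e} isC e∈C = proj₂ (proj₂ (proj₂ (unique e))) _ isC e∈C

  shared-edge⇒same-circuit : ∀ {f r r′} → f ∈ circuitOf r → f ∈ circuitOf r′ → circuitOf r ≡ circuitOf r′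
  shared-edge⇒same-circuit {r = r} {r′} f∈r f∈r′ =
    trans (circuitOf-unique (circuitOf-isCircuit r) f∈r) (sym (circuitOf-unique (circuitOf-isCircuit r′) f∈r′))

  -- Sums over circuits are taken over all edges, counting each circuit at its least edge, its leader.
  IsLeader : Fin m → Set
  IsLeader r = ∀ f → f ∈ circuitOf r → r Fin.≤ f

  leader? : ∀ r → Dec (IsLeader r)
  leader? r = Fin.all? λ f → (f ∈? circuitOf r) →-dec (r Fin.≤? f)

  leaderOf : ∀ e → ∃ λ r → IsLeader r × circuitOf r ≡ circuitOf e
  leaderOf e with least (_∈? circuitOf e) (∈-circuitOf e)
  ... | r , r∈ , minimal = r , (λ f f∈ → minimal f (subst (f ∈_) same f∈)) , same
    where
    same : circuitOf r ≡ circuitOf e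
    same = sym (circuitOf-unique (circuitOf-isCircuit e) r∈)

  leader-unique : ∀ {r r′} → IsLeader r → IsLeader r′ → circuitOf r ≡ circuitOf r′ → r ≡ r′
  leader-unique {r} {r′} leader leader′ same = Fin.≤-antisym
    (leader r′ (subst (r′ ∈_) (sym same) (∈-circuitOf r′))) (leader′ r (subst (r ∈_) same (∈-circuitOf r)))

  cycle : (r : Fin m) → Cycle G (circuitOf r)
  cycle r = isCircuit⇒cycle G (circuitOf-isCircuit r)

  module CycleOf (r : Fin m) = Cycle (cycle r)
  open CycleOf using (len; node; edge; visits)

  OnCycle : Fin m → Fin n → Set
  OnCycle r v = ∃ λ j → j < len r × node r j ≡ v

  circuit-leader : ∀ {v C} → IsCircuit G C → IncidentCircuit G v C →
                   ∃ λ r → IsLeader r × circuitOf r ≡ C × OnCycle r v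
  circuit-leader isC (e , e∈C , v∼e) with leaderOf e
  ... | r , leader , same = r , leader , trans same (sym (circuitOf-unique isC e∈C)) ,
                            CycleOf.incident⇒on-cycle r (subst (e ∈_) (sym same) (∈-circuitOf e)) v∼e

  rank : Fin m → ℕ
  rank r = indicator (leader? r) * (len r ∸ 1)

  leaderPath : ∀ r → Dec (IsLeader r) → List (Fin m)
  leaderPath r (yes _) = tabulate {n = len r ∸ 1} (edge r ∘ toℕ)
  leaderPath r (no _) = []

  -- Every circuit minus its last edge: it contains no whole circuit, so it is a forest.
  forest : List (Fin m)
  forest = concat (tabulate λ r → leaderPath r (leader? r))

  ∈-leaderPath⁻ : ∀ {f} r (d : Dec (IsLeader r)) → f ∈ₗ leaderPath r d →
                  IsLeader r × ∃ λ j → j < len r ∸ 1 × edge r j ≡ f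
  ∈-leaderPath⁻ r (yes leader) f∈ = let j , f≡ = ∈-tabulate⁻ f∈ in leader , toℕ j , toℕ<n j , sym f≡

  ∈-forest⁻ : ∀ {f} → f ∈ₗ forest → ∃ λ r → IsLeader r × ∃ λ j → j < len r ∸ 1 × edge r j ≡ f
  ∈-forest⁻ f∈ with ∈-concat⁻′ _ f∈
  ... | _ , f∈path , path∈ with ∈-tabulate⁻ {f = λ r → leaderPath r (leader? r)} path∈
  ...   | r , refl = r , ∈-leaderPath⁻ r (leader? r) f∈path

  <len∸1⇒<len : ∀ {r j} → j < len r ∸ 1 → j < len r
  <len∸1⇒<len j< = <-≤-trans j< (m∸n≤m _ 1)

  length-forest : length forest ≡ ∑[ r < m ] rank r
  length-forest = trans (length-concat-tabulate (λ r → leaderPath r (leader? r)))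
                        (sum-cong-≗ {m} λ r → length-leaderPath r (leader? r))
    where
    length-leaderPath : ∀ r (d : Dec (IsLeader r)) → length (leaderPath r d) ≡ indicator d * (len r ∸ 1)
    length-leaderPath r (yes _) = trans (length-tabulate _) (sym (+-identityʳ _))
    length-leaderPath r (no _) = refl

  forest-unique : Unique forest
  forest-unique = Unique.concat⁺ (All.tabulate⁺ λ r → path-unique r (leader? r))
                                 (AllPairs.tabulate⁺ λ r≢r′ → paths-disjoint r≢r′ (leader? _) (leader? _))
    where
    path-unique : ∀ r (d : Dec (IsLeader r)) → Unique (leaderPath r d)
    path-unique r (yes _) = Unique.tabulate⁺ λ {i} {j} eq →
      toℕ-injective (CycleOf.edge-injective r (<len∸1⇒<len (toℕ<n i)) (<len∸1⇒<len (toℕ<n j)) eq)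
    path-unique r (no _) = []
    paths-disjoint : ∀ {r r′} → r ≢ r′ → (d : Dec (IsLeader r)) (d′ : Dec (IsLeader r′)) →
                     Disjoint (leaderPath r d) (leaderPath r′ d′)
    paths-disjoint {r} {r′} r≢r′ d d′ (f∈ , f∈′)
      with ∈-leaderPath⁻ r d f∈ | ∈-leaderPath⁻ r′ d′ f∈′
    ... | leader , _ , j< , refl | leader′ , _ , j′< , eq′ =
      r≢r′ (leader-unique leader leader′ (shared-edge⇒same-circuit
        (CycleOf.edge∈ r (<len∸1⇒<len j<)) (subst (_∈ circuitOf r′) eq′ (CycleOf.edge∈ r′ (<len∸1⇒<len j′<)))))

  forest-misses-circuit : ∀ {C} → IsCircuit G C → ∃ λ f → f ∈ C × f ∉ₗ forest
  forest-misses-circuit {C} isC with leaderOf (Cycle.edge (isCircuit⇒cycle G isC) 0)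
  ... | r , leader , same = last , last∈C , last∉forest
    where
    open Cycle (isCircuit⇒cycle G isC) using (edge∈; 0<len)
    r-circuit : circuitOf r ≡ C
    r-circuit = trans same (sym (circuitOf-unique isC (edge∈ 0<len)))
    last = edge r (len r ∸ 1)
    last<len : len r ∸ 1 < len r
    last<len = CycleOf.prev<len r (CycleOf.0<len r)
    last∈C : last ∈ C
    last∈C = subst (last ∈_) r-circuit (CycleOf.edge∈ r last<len)
    last∉forest : last ∉ₗ forest
    last∉forest last∈ with ∈-forest⁻ last∈
    ... | r′ , leader′ , j , j< , eq
      with leader-unique leader′ leader
             (shared-edge⇒same-circuit (subst (_∈ circuitOf r′) eq (CycleOf.edge∈ r′ (<len∸1⇒<len j<)))
                                        (CycleOf.edge∈ r last<len))
    ...   | refl = <-irrefl (CycleOf.edge-injective r (<len∸1⇒<len j<) last<len eq) j<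

  ∑rank<n : Fin n → ∑[ r < m ] rank r < n
  ∑rank<n x = subst (_< n) length-forest
    (acyclic-length G x (circuit-free⇒acyclic G loopless forest-unique forest-misses-circuit))

  weight : Fin m → ℕ
  weight r = indicator (leader? r) * cycleWeight (len r)

  share : Fin n → Fin m → ℕ
  share v r = weight r * visits r v

  nodeWeight : Fin n → ℕ
  nodeWeight v = ∑[ r < m ] share v r

  ∑nodeWeight≤6*∑rank : ∑[ v < n ] nodeWeight v ≤ 6 * ∑[ r < m ] rank r
  ∑nodeWeight≤6*∑rank = begin
    ∑[ v < n ] ∑[ r < m ] share v r            ≡⟨ ∑-comm {n} {m} share ⟩
    ∑[ r < m ] ∑[ v < n ] (weight r * visits r v)
                                               ≡⟨ sum-cong-≗ {m} (λ r → trans (∑-*ˡ (weight r) (visits r))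
                                                                    (cong (weight r *_) (CycleOf.∑-visits r))) ⟩
    ∑[ r < m ] (weight r * len r)              ≤⟨ sum-mono-≤ (λ r → circuit-bound r (leader? r)) ⟩
    ∑[ r < m ] (6 * rank r)                    ≡⟨ ∑-*ˡ 6 rank ⟩
    6 * ∑[ r < m ] rank r                      ∎
    where
    open ≤-Reasoning
    circuit-bound : ∀ r (d : Dec (IsLeader r)) →
                    indicator d * cycleWeight (len r) * len r ≤ 6 * (indicator d * (len r ∸ 1))
    circuit-bound r (yes _) = subst₂ (λ a b → a * len r ≤ 6 * b)
                                (sym (+-identityʳ (cycleWeight (len r)))) (sym (+-identityʳ (len r ∸ 1)))
                         (cycleWeight*k≤6*[k-1] (len r) (CycleOf.2≤len r))
    circuit-bound r (no _) = z≤n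

  leader-share : ∀ {r v} → IsLeader r → OnCycle r v → cycleWeight (len r) ≤ share v r
  leader-share {r} {v} leader (j , j<len , node-j) = begin
    cycleWeight (len r)                                   ≡⟨ *-identityʳ (cycleWeight (len r)) ⟨
    cycleWeight (len r) * 1                               ≤⟨ *-monoʳ-≤ (cycleWeight (len r))
                                                                 (CycleOf.on-cycle⇒visits r j<len node-j) ⟩
    cycleWeight (len r) * visits r v                      ≡⟨ cong (_* visits r v)
                                                                 (*-identityˡ (cycleWeight (len r))) ⟨
    1 * cycleWeight (len r) * visits r v                  ≡⟨ cong (λ i → i * cycleWeight (len r) * visits r v)
                                                                 (indicator-yes (leader? r) leader) ⟨
    share v r                                             ∎
    where open ≤-Reasoning

  3≤share : ∀ {r v} → IsLeader r → OnCycle r v → 3 ≤ share v r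
  3≤share leader on = ≤-trans (3≤cycleWeight _) (leader-share leader on)

  4≤share : ∀ {r v} → IsLeader r → OnCycle r v → len r ≢ 2 → 4 ≤ share v r
  4≤share {r} {v} leader on len≢2 = subst (_≤ share v r) (cycleWeight-≢2 len≢2) (leader-share leader on)

  R₂⇒7≤nodeWeight : ∀ {v} → InR₂ G v → 7 ≤ nodeWeight v
  R₂⇒7≤nodeWeight {v} (inj₁ (_ , _ , _ , isC₁ , isC₂ , isC₃ , C₁≢C₂ , C₁≢C₃ , C₂≢C₃ , v∼C₁ , v∼C₂ , v∼C₃))
    with circuit-leader isC₁ v∼C₁ | circuit-leader isC₂ v∼C₂ | circuit-leader isC₃ v∼C₃
  ... | r₁ , l₁ , refl , on₁ | r₂ , l₂ , refl , on₂ | r₃ , l₃ , refl , on₃ =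
    ≤-trans (m≤m+n 7 2) (≤-trans (+-mono-≤ (+-mono-≤ (3≤share l₁ on₁) (3≤share l₂ on₂)) (3≤share l₃ on₃))
      (three-terms≤sum (share v) (C₁≢C₂ ∘ cong circuitOf) (C₁≢C₃ ∘ cong circuitOf) (C₂≢C₃ ∘ cong circuitOf)))
  R₂⇒7≤nodeWeight {v} (inj₂ (_ , _ , isC₁ , isC₂ , C₁≢C₂ , v∼C₁ , v∼C₂ , not-both-2))
    with circuit-leader isC₁ v∼C₁ | circuit-leader isC₂ v∼C₂
  ... | r₁ , l₁ , refl , on₁ | r₂ , l₂ , refl , on₂ =
    ≤-trans (seven (len r₁ ℕ.≟ 2) (len r₂ ℕ.≟ 2)) (two-terms≤sum (share v) (C₁≢C₂ ∘ cong circuitOf))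
    where
    seven : Dec (len r₁ ≡ 2) → Dec (len r₂ ≡ 2) → 7 ≤ share v r₁ + share v r₂
    seven (no len₁≢2) _ = +-mono-≤ (4≤share l₁ on₁ len₁≢2) (3≤share l₂ on₂)
    seven (yes _) (no len₂≢2) = +-mono-≤ (3≤share l₁ on₁) (4≤share l₂ on₂ len₂≢2)
    seven (yes len₁≡2) (yes len₂≡2) =
      ⊥-elim (not-both-2 ((isC₁ , CycleOf.∣C∣≡2 r₁ len₁≡2) , (isC₂ , CycleOf.∣C∣≡2 r₂ len₂≡2)))

  degree≡2⇒∈R₁ : ∀ {v} → degree G v ≡ 2 → v ∈ R₁ G
  degree≡2⇒∈R₁ {v} deg≡2 = lookup⇒[]= v (R₁ G)
    (trans (lookup∘tabulate (λ x → degree G x ℕ.≡ᵇ 2) v) (Equivalence.to T-≡ (≡⇒≡ᵇ _ 2 deg≡2)))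

  -- A node on one circuit only has degree 2; otherwise it collects two shares.
  6≤nodeWeight+3*R₁ : ∀ {v e} → IncidentEdge G v e → 6 ≤ nodeWeight v + 3 * indicator (v ∈? R₁ G)
  6≤nodeWeight+3*R₁ {v} {e} v∼e with circuit-leader (circuitOf-isCircuit e) (e , ∈-circuitOf e , v∼e)
  ... | r₀ , l₀ , _ , on₀ with Fin.any? (λ f → T? (incidentᵇ G v f) ×-dec ¬? (f ∈? circuitOf r₀))
  ...   | yes (f , v∼ᵇf , f∉r₀)
    with circuit-leader (circuitOf-isCircuit f) (f , ∈-circuitOf f , incidentᵇ⇒incident G v∼ᵇf)
  ...     | r , l , r-circuit , on = begin
    6                                        ≤⟨ +-mono-≤ (3≤share l₀ on₀) (3≤share l on) ⟩
    share v r₀ + share v r                   ≤⟨ two-terms≤sum (share v) r₀≢r ⟩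
    nodeWeight v                             ≤⟨ m≤m+n (nodeWeight v) _ ⟩
    nodeWeight v + 3 * indicator (v ∈? R₁ G) ∎
    where
    open ≤-Reasoning
    r₀≢r : r₀ ≢ r
    r₀≢r refl = f∉r₀ (subst (f ∈_) (sym r-circuit) (∈-circuitOf f))
  6≤nodeWeight+3*R₁ {v} {e} v∼e | r₀ , l₀ , _ , j , j<len , node-j | no none = begin
    6                                        ≤⟨ +-monoˡ-≤ 3 (3≤share l₀ (j , j<len , node-j)) ⟩
    share v r₀ + 3                           ≤⟨ +-mono-≤ (term≤sum (share v) r₀) (≤-reflexive (cong (3 *_) v∈R₁)) ⟩
    nodeWeight v + 3 * indicator (v ∈? R₁ G) ∎
    where
    open ≤-Reasoning
    all-in : ∀ {f} → IncidentEdge G v f → f ∈ circuitOf r₀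
    all-in {f} v∼f with f ∈? circuitOf r₀
    ... | yes f∈ = f∈
    ... | no f∉ = ⊥-elim (none (f , incident⇒incidentᵇ G v∼f , f∉))
    v∈R₁ : 1 ≡ indicator (v ∈? R₁ G)
    v∈R₁ = sym (indicator-yes (v ∈? R₁ G) (degree≡2⇒∈R₁ (CycleOf.degree≡2 r₀ j<len node-j all-in)))

  6+∣S∣≤3*∣R₁∣ : ∀ {S} → (∀ v → v ∈ S → InR₂ G v) → (∀ v → ∃ (IncidentEdge G v)) → Fin n →
                6 + ∣ S ∣ ≤ 3 * ∣ R₁ G ∣
  6+∣S∣≤3*∣R₁∣ {S} S⊆R₂ incident x = +-cancelˡ-≤ W _ _ (begin
    W + (6 + ∣ S ∣)                                          ≡⟨ +-assoc W 6 ∣ S ∣ ⟨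
    W + 6 + ∣ S ∣                                            ≤⟨ +-monoˡ-≤ ∣ S ∣ W+6≤n*6 ⟩
    n * 6 + ∣ S ∣                                            ≡⟨ cong₂ _+_ (sym (∑-const n 6)) (∣p∣≡count S) ⟩
    ∑[ v < n ] 6 + ∑[ v < n ] indicator (v ∈? S)             ≡⟨ ∑-distrib-+ (λ _ → 6) (λ v → indicator (v ∈? S)) ⟨
    ∑[ v < n ] (6 + indicator (v ∈? S))                      ≤⟨ sum-mono-≤ node-bound ⟩
    ∑[ v < n ] (nodeWeight v + 3 * indicator (v ∈? R₁ G))    ≡⟨ ∑-distrib-+ nodeWeight _ ⟩
    W + ∑[ v < n ] (3 * indicator (v ∈? R₁ G))               ≡⟨ cong (W +_) (∑-*ˡ 3 (λ v → indicator (v ∈? R₁ G))) ⟩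
    W + 3 * count (_∈? R₁ G)                                 ≡⟨ cong (λ k → W + 3 * k) (∣p∣≡count (R₁ G)) ⟨
    W + 3 * ∣ R₁ G ∣                                         ∎)
    where
    open ≤-Reasoning
    W = ∑[ v < n ] nodeWeight v
    W+6≤n*6 : W + 6 ≤ n * 6
    W+6≤n*6 = begin
      W + 6                              ≤⟨ +-monoˡ-≤ 6 ∑nodeWeight≤6*∑rank ⟩
      6 * ∑[ r < m ] rank r + 6          ≡⟨ trans (+-comm (6 * ∑[ r < m ] rank r) 6) (sym (*-suc 6 _)) ⟩
      6 * suc (∑[ r < m ] rank r)        ≤⟨ *-monoʳ-≤ 6 (∑rank<n x) ⟩
      6 * n                              ≡⟨ *-comm 6 n ⟩
      n * 6                              ∎
    node-bound : ∀ v → 6 + indicator (v ∈? S) ≤ nodeWeight v + 3 * indicator (v ∈? R₁ G)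
    node-bound v with v ∈? S
    ... | yes v∈S = ≤-trans (R₂⇒7≤nodeWeight (S⊆R₂ v v∈S)) (m≤m+n _ _)
    ... | no _ = 6≤nodeWeight+3*R₁ (proj₂ (incident v))

6+s≤3q⇒s+8≤4q : ∀ s q → 6 + s ≤ 3 * q → s + 8 ≤ 4 * q
6+s≤3q⇒s+8≤4q s 1 (s≤s (s≤s (s≤s ())))
6+s≤3q⇒s+8≤4q s q@(suc (suc _)) 6+s≤3q = begin
  s + 8          ≡⟨ +-comm s 8 ⟩
  2 + (6 + s)    ≤⟨ +-mono-≤ (s≤s (s≤s z≤n)) 6+s≤3q ⟩
  q + 3 * q      ∎
  where open ≤-Reasoning

proposition7 : (G : Multigraph) → IsCactus G → 2 ≤ Multigraph.n G →
    (S : Subset (Multigraph.n G)) → (∀ v → v ∈ S → InR₂ G v) →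
    ∣ S ∣ + 8 ≤ 4 * ∣ R₁ G ∣
proposition7 G (loopless , (connected , _) , unique) 2≤n S S⊆R₂ =
  6+s≤3q⇒s+8≤4q ∣ S ∣ ∣ R₁ G ∣
    (Cactus.6+∣S∣≤3*∣R₁∣ G loopless unique S⊆R₂ (connected⇒incident G connected 2≤n) (fromℕ< 2≤n))
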